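{- Let $H^{\mathrm{sp}}$ be the splitter graph with specified vertices $g, h, h_1, h_2, h_3$ (defined in the context). Let $T$ be a subgraph of $H^{\mathrm{sp}}$ that is a union of pairwise vertex-disjoint triangles, such that $V(T) \supseteq V(H^{\mathrm{sp}}) \setminus \{g, h, h_1, h_2, h_3\}$ and $\lvert V(T) \cap \{g, h\}\rvert=1$. Then $V(T)\cap \{g,h,h_1,h_2,h_3\}$ is either $\{g\}$ or $\{h,h_1,h_2,h_3\}$. In addition, for each of these two cases, there exists such a subgraph $T$.
   Context: Define the graph $L(g,g_1,g_2)$ with vertex set $\{g,g_1,g_2,h^1_1,h^1_2,h^2_1,h^2_2,h^2_3,h^2_4\}$ and edge set $\{gh^1_1, gh^1_2, h^1_1h^1_2, h^1_1h^2_1, h^1_1h^2_2, h^1_2h^2_3, h^1_2h^2_4, h^2_1h^2_2, h^2_2h^2_3, h^2_3h^2_4, h^2_1g_1, h^2_2g_1, h^2_3g_2, h^2_4g_2\}$. The splitter $H^{\mathrm{sp}}$ is built from three vertex-disjoint copies of $L$: a copy $L(g,g_1,g_2)$, a copy $L(g^1,h_1,h_2)$ (in which $g^1,h_1,h_2$ play the roles of $g,g_1,g_2$), and a copy $L(g^2,h_3,g^2_2)$ (in which $g^2,h_3,g^2_2$ play the roles of $g,g_1,g_2$); then identify $g_1$ with $g^1$ and $g_2$ with $g^2$, add three new vertices $w_1,w_2,h$, and add the edges $g^2_2w_1, g^2_2w_2, w_1w_2, w_1h, w_2h$. The specified vertices are $g,h,h_1,h_2,h_3$. -}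

module Defs where

open import Data.Product using (_×_; _,_)
open import Data.Sum using (_⊎_)
open import Data.List using (List; []; _∷_; _++_)
open import Data.List.Relation.Unary.Any using (Any)
open import Data.List.Relation.Unary.AllPairs using (AllPairs)
open import Data.List.Membership.Propositional using (_∈_)
open import Data.List.Relation.Binary.Disjoint.Propositional using (Disjoint)
open import Relation.Binary.PropositionalEquality using (_≡_)
open import Relation.Nullary using (¬_)

-- Copy 1, L(g, gA, gB):          internal vertices a11 a12 a21 a22 a23 a24
--   Copy 2, L(gA, h1, h2):         internal vertices b11 b12 b21 b22 b23 b24
--   Copy 3, L(gB, h3, g22):        internal vertices c11 c12 c21 c22 c23 c24
-- gA is g_1 = g^1 and gB is g_2 = g^2 (the identified vertices); g22 is g^2_2.
data V : Set where
  g gA gB h1 h2 h3 g22 w1 w2 h : V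
  a11 a12 a21 a22 a23 a24 : V
  b11 b12 b21 b22 b23 b24 : V
  c11 c12 c21 c22 c23 c24 : V

-- Edge list of the gadget L(x, x1, x2) with internal vertices
-- y11 = h^1_1, y12 = h^1_2, y21 = h^2_1, ..., y24 = h^2_4.
Ledges : (x x1 x2 y11 y12 y21 y22 y23 y24 : V) → List (V × V)
Ledges x x1 x2 y11 y12 y21 y22 y23 y24 =
  (x , y11) ∷ (x , y12) ∷ (y11 , y12) ∷ (y11 , y21) ∷ (y11 , y22) ∷
  (y12 , y23) ∷ (y12 , y24) ∷ (y21 , y22) ∷ (y22 , y23) ∷ (y23 , y24) ∷
  (y21 , x1) ∷ (y22 , x1) ∷ (y23 , x2) ∷ (y24 , x2) ∷ []

Esp : List (V × V)
Esp = Ledges g gA gB a11 a12 a21 a22 a23 a24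
   ++ Ledges gA h1 h2 b11 b12 b21 b22 b23 b24
   ++ Ledges gB h3 g22 c11 c12 c21 c22 c23 c24
   ++ ((g22 , w1) ∷ (g22 , w2) ∷ (w1 , w2) ∷ (w1 , h) ∷ (w2 , h) ∷ [])

Adj : V → V → Set
Adj u v = ((u , v) ∈ Esp) ⊎ ((v , u) ∈ Esp)

record Triangle : Set where
  constructor tri
  field
    x y z : V
    xy : Adj x y
    yz : Adj y z
    xz : Adj x z

verts : Triangle → List V
verts t = Triangle.x t ∷ Triangle.y t ∷ Triangle.z t ∷ []

-- A subgraph T of H^sp which is a union of triangles, given as a list
-- of triangles; "pairwise vertex-disjoint" is required separately.
PairwiseVertexDisjoint : List Triangle → Set
PairwiseVertexDisjoint T = AllPairs (λ s t → Disjoint (verts s) (verts t)) T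

InV : V → List Triangle → Set
InV v T = Any (λ t → v ∈ verts t) T

Specified : V → Set
Specified v = v ≡ g ⊎ v ≡ h ⊎ v ≡ h1 ⊎ v ≡ h2 ⊎ v ≡ h3

Admissible : List Triangle → Set
Admissible T =
  PairwiseVertexDisjoint T ×
  (∀ v → ¬ Specified v → InV v T) ×
  ((InV g T × ¬ InV h T) ⊎ (¬ InV g T × InV h T))

CaseG : List Triangle → Set
CaseG T = InV g T × ¬ InV h T × ¬ InV h1 T × ¬ InV h2 T × ¬ InV h3 T

CaseH : List Triangle → Set
CaseH T = ¬ InV g T × InV h T × InV h1 T × InV h2 T × InV h3 T

-- Each copy L(x, x₁, x₂) of the gadget inside H^sp is covered in one of two ways: "top", by its
-- triangle {x, h¹₁, h¹₂} and the two foot triangles through x₁ and x₂, or "middle", by its two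
-- middle triangles, which leaves x, x₁, x₂ to triangles outside the copy. As g¹ and g² are the
-- apexes of the second and third copy, a top first copy forces both others to be middle; then
-- h₁, h₂, h₃ stay uncovered and g²₂ must take the triangle g²₂w₁w₂, which shuts h out. A middle
-- first copy forces g¹ and g² into the apex triangles of the other two copies, which are then
-- top; so h₁, h₂, h₃ and g²₂ are covered inside the copies and w₁ must take the triangle w₁w₂h.
module Submission where

open import Defs
open import Data.Fin using (Fin; #_)
import Data.Fin.Properties as Fin
open import Data.List using (List; []; _∷_; _++_; map; filter; lookup)
open import Data.List.Membership.Propositional using (_∈_; find; lose)
open import Data.List.Membership.Propositional.Properties
  using (∈-lookup; ∈-map⁺; ∈-++⁺ˡ; ∈-++⁺ʳ; ∈-filter⁺)
open import Data.List.Relation.Unary.All as All using (All)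
open import Data.List.Relation.Unary.AllPairs using (AllPairs; _∷_; allPairs?)
open import Data.List.Relation.Unary.Any as Any using (Any; here; there; any?)
open import Data.List.Relation.Unary.Any.Properties using (singleton⁻)
open import Data.List.Relation.Binary.Disjoint.Propositional using (Disjoint)
open import Data.Empty using (⊥-elim)
open import Data.Product using (_×_; _,_; Σ; proj₁; proj₂; uncurry; swap)
import Data.Product.Properties as Product
open import Data.Sum using (_⊎_; inj₁; inj₂; [_,_]′)
import Data.Sum as Sum
open import Function using (_∘_; case_of_)
open import Relation.Binary.Construct.Closure.Reflexive using (ReflClosure; refl; [_])
import Relation.Binary.Construct.Closure.Reflexive.Properties as ReflClosure
open import Relation.Binary.Definitions using (DecidableEquality; Decidable)
open import Relation.Binary.PropositionalEquality using (_≡_; _≢_; refl; sym; trans; cong; subst)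
open import Relation.Nullary using (¬_; Dec; contradiction)
open import Relation.Nullary.Decidable
  using (True; False; map′; toWitness; toWitnessFalse; from-yes; ¬?; _×-dec_; _⊎-dec_; _→-dec_)

pairs : {A : Set} → List A → List (A × A)
pairs []       = []
pairs (x ∷ xs) = map (x ,_) xs ++ pairs xs

∈-pairs⁺ : {A : Set} {x y : A} {xs : List A} →
           x ∈ xs → y ∈ xs → x ≢ y → (x , y) ∈ pairs xs ⊎ (y , x) ∈ pairs xs
∈-pairs⁺ (here refl)   (here refl)   x≢y = ⊥-elim (x≢y refl)
∈-pairs⁺ (here refl)   (there y∈xs)  _   = inj₁ (∈-++⁺ˡ (∈-map⁺ _ y∈xs))
∈-pairs⁺ (there x∈xs)  (here refl)   _   = inj₂ (∈-++⁺ˡ (∈-map⁺ _ x∈xs))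
∈-pairs⁺ (there x∈xs)  (there y∈xs)  x≢y =
  Sum.map (∈-++⁺ʳ _) (∈-++⁺ʳ _) (∈-pairs⁺ x∈xs y∈xs x≢y)

module DisjointBlocks {A B : Set} (block : A → List B) where

  Together : List A → B → B → Set
  Together F u v = Any (λ a → u ∈ block a × v ∈ block a) F

  together-sym : ∀ {F u v} → Together F u v → Together F v u
  together-sym = Any.map swap

  together-trans : ∀ {F u v w} → AllPairs (λ a b → Disjoint (block a) (block b)) F →
                   Together F u v → Together F v w → Together F u w
  together-trans (_ ∷ _)  (here (u∈a , _)) (here (_ , w∈a)) = here (u∈a , w∈a)
  together-trans (a# ∷ _) (here (_ , v∈a)) (there q)        =
    let a#b , v∈b , _ = All.lookupAny a# q in ⊥-elim (a#b (v∈a , v∈b))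
  together-trans (a# ∷ _) (there p)        (here (v∈a , _)) =
    let a#b , _ , v∈b = All.lookupAny a# p in ⊥-elim (a#b (v∈a , v∈b))
  together-trans (_ ∷ #)  (there p)        (there q)        = there (together-trans # p q)

open DisjointBlocks verts using (together-sym; together-trans)
  renaming (Together to SameTriangle)

vertices : List V
vertices = g ∷ gA ∷ gB ∷ h1 ∷ h2 ∷ h3 ∷ g22 ∷ w1 ∷ w2 ∷ h ∷
           a11 ∷ a12 ∷ a21 ∷ a22 ∷ a23 ∷ a24 ∷
           b11 ∷ b12 ∷ b21 ∷ b22 ∷ b23 ∷ b24 ∷
           c11 ∷ c12 ∷ c21 ∷ c22 ∷ c23 ∷ c24 ∷ []

position : (v : V) → Σ (Fin 28) (λ i → lookup vertices i ≡ v)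
position g   = # 0 , refl
position gA  = # 1 , refl
position gB  = # 2 , refl
position h1  = # 3 , refl
position h2  = # 4 , refl
position h3  = # 5 , refl
position g22 = # 6 , refl
position w1  = # 7 , refl
position w2  = # 8 , refl
position h   = # 9 , refl
position a11 = # 10 , refl
position a12 = # 11 , refl
position a21 = # 12 , refl
position a22 = # 13 , refl
position a23 = # 14 , refl
position a24 = # 15 , refl
position b11 = # 16 , refl
position b12 = # 17 , refl
position b21 = # 18 , refl
position b22 = # 19 , refl
position b23 = # 20 , refl
position b24 = # 21 , refl
position c11 = # 22 , refl
position c12 = # 23 , refl
position c21 = # 24 , refl
position c22 = # 25 , refl
position c23 = # 26 , refl
position c24 = # 27 , refl

∈-vertices : ∀ v → v ∈ vertices
∈-vertices v = subst (_∈ vertices) (proj₂ (position v)) (∈-lookup (proj₁ (position v)))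

_≟_ : DecidableEquality V
u ≟ v = map′ injective (cong (proj₁ ∘ position)) (proj₁ (position u) Fin.≟ proj₁ (position v))
  where
  injective : proj₁ (position u) ≡ proj₁ (position v) → u ≡ v
  injective i≡j = trans (sym (proj₂ (position u)))
                        (trans (cong (lookup vertices) i≡j) (proj₂ (position v)))

∀-vertex? : {P : V → Set} → (∀ v → Dec (P v)) → Dec (∀ v → P v)
∀-vertex? P? = map′ (λ all v → All.lookup all (∈-vertices v)) (λ ∀P → All.tabulate (λ _ → ∀P _))
                    (All.all? P? vertices)

open import Data.List.Membership.DecPropositional (Product.≡-dec _≟_ _≟_) using (_∈?_)
open import Data.List.Relation.Binary.Disjoint.DecPropositional _≟_ using (disjoint?)

Adj? : Decidable Adj
Adj? u v = (u , v) ∈? Esp ⊎-dec (v , u) ∈? Esp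

Adj-sym : ∀ {u v} → Adj u v → Adj v u
Adj-sym = Sum.swap

Adj-irreflexive : ∀ {v} → ¬ Adj v v
Adj-irreflexive {v} = [ loop , loop ]′
  where
  loopless : All (λ (x , y) → x ≢ y) Esp
  loopless = from-yes (All.all? (λ (x , y) → ¬? (x ≟ y)) Esp)
  loop : ¬ (v , v) ∈ Esp
  loop v∈Esp = All.lookup loopless v∈Esp refl

Adj⁼ : V → V → Set
Adj⁼ = ReflClosure Adj

Adj⁼? : Decidable Adj⁼
Adj⁼? = ReflClosure.dec _≟_ Adj?

specified? : ∀ v → Dec (Specified v)
specified? v = v ≟ g ⊎-dec v ≟ h ⊎-dec v ≟ h1 ⊎-dec v ≟ h2 ⊎-dec v ≟ h3

-- The edges p q of the neighbourhood of v, i.e. the triangles v p q of H^sp, each listed once.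
link : V → List (V × V)
link v = filter (uncurry Adj?) (pairs (filter (Adj? v) vertices))

∈-link⁺ : ∀ {v p q} → Adj v p → Adj v q → Adj p q → (p , q) ∈ link v ⊎ (q , p) ∈ link v
∈-link⁺ {v} vp vq pq =
  Sum.map (λ e → ∈-filter⁺ (uncurry Adj?) e pq) (λ e → ∈-filter⁺ (uncurry Adj?) e (Adj-sym pq))
          (∈-pairs⁺ (neighbour vp) (neighbour vq) (λ { refl → Adj-irreflexive pq }))
  where
  neighbour : ∀ {u} → Adj v u → u ∈ filter (Adj? v) vertices
  neighbour vu = ∈-filter⁺ (Adj? v) (∈-vertices _) vu

pattern 1st = here refl
pattern 2nd = there (here refl)
pattern 3rd = there (there (here refl))

triangle-adj⁼ : ∀ (t : Triangle) {u v} → u ∈ verts t → v ∈ verts t → Adj⁼ u v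
triangle-adj⁼ (tri _ _ _ xy yz xz) = λ
  { 1st 1st → refl
  ; 1st 2nd → [ xy ]
  ; 1st 3rd → [ xz ]
  ; 2nd 1st → [ Adj-sym xy ]
  ; 2nd 2nd → refl
  ; 2nd 3rd → [ yz ]
  ; 3rd 1st → [ Adj-sym xz ]
  ; 3rd 2nd → [ Adj-sym yz ]
  ; 3rd 3rd → refl
  }

sameTriangle⇒adj⁼ : ∀ {T u v} → SameTriangle T u v → Adj⁼ u v
sameTriangle⇒adj⁼ together = let t , _ , u∈t , v∈t = find together in triangle-adj⁼ t u∈t v∈t

link-edge : ∀ {v p q} {P : V × V → Set} →
            Adj v p → Adj v q → Adj p q → P (p , q) → P (q , p) → Any P (link v)
link-edge vp vq pq Ppq Pqp = [ (λ e → lose e Ppq) , (λ e → lose e Pqp) ]′ (∈-link⁺ vp vq pq)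

triangle-link : ∀ (t : Triangle) {v} → v ∈ verts t →
                Any (λ (p , q) → p ∈ verts t × q ∈ verts t) (link v)
triangle-link (tri _ _ _ xy yz xz) 1st = link-edge xy xz yz (2nd , 3rd) (3rd , 2nd)
triangle-link (tri _ _ _ xy yz xz) 2nd = link-edge (Adj-sym xy) yz xz (1st , 3rd) (3rd , 1st)
triangle-link (tri _ _ _ xy yz xz) 3rd =
  link-edge (Adj-sym xz) (Adj-sym yz) xy (1st , 2nd) (2nd , 1st)

covered⇒link : ∀ {T v} → InV v T →
               Any (λ (p , q) → SameTriangle T v p × SameTriangle T v q) (link v)
covered⇒link covered =
  let t , t∈T , v∈t = find covered
  in Any.map (λ (p∈t , q∈t) → lose t∈T (v∈t , p∈t) , lose t∈T (v∈t , q∈t)) (triangle-link t v∈t)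

-- L x x₁ x₂ y₁₁ … y₂₄ is the copy L(x, x₁, x₂) with internal vertices hⁱⱼ = yᵢⱼ.
record Gadget : Set where
  constructor L
  field x x₁ x₂ y₁₁ y₁₂ y₂₁ y₂₂ y₂₃ y₂₄ : V

L₁ L₂ L₃ : Gadget
L₁ = L g  gA gB  a11 a12 a21 a22 a23 a24
L₂ = L gA h1 h2  b11 b12 b21 b22 b23 b24
L₃ = L gB h3 g22 c11 c12 c21 c22 c23 c24

record IsGadget (ℓ : Gadget) : Set where
  open Gadget ℓ
  field
    link-y₁₁ : link y₁₁ ≡ (x , y₁₂) ∷ (y₂₁ , y₂₂) ∷ []
    link-y₁₂ : link y₁₂ ≡ (x , y₁₁) ∷ (y₂₃ , y₂₄) ∷ []
    link-y₂₁ : link y₂₁ ≡ (x₁ , y₂₂) ∷ (y₁₁ , y₂₂) ∷ []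
    link-y₂₃ : link y₂₃ ≡ (x₂ , y₂₄) ∷ (y₁₂ , y₂₄) ∷ []
    y₁₁-unspecified : False (specified? y₁₁)
    y₁₂-unspecified : False (specified? y₁₂)
    y₂₁-unspecified : False (specified? y₂₁)
    y₂₃-unspecified : False (specified? y₂₃)
    x≁y₂₁   : False (Adj⁼? x y₂₁)
    x≁y₂₃   : False (Adj⁼? x y₂₃)
    y₁₂≁y₂₁ : False (Adj⁼? y₁₂ y₂₁)
    x₁≁y₁₁  : False (Adj⁼? x₁ y₁₁)
    x₂≁y₁₂  : False (Adj⁼? x₂ y₁₂)

-- For concrete vertices a False type evaluates to ⊤, so such fields and arguments are omitted
-- here and written _ below.
L₁-isGadget : IsGadget L₁
L₁-isGadget = record { link-y₁₁ = refl ; link-y₁₂ = refl ; link-y₂₁ = refl ; link-y₂₃ = refl }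

L₂-isGadget : IsGadget L₂
L₂-isGadget = record { link-y₁₁ = refl ; link-y₁₂ = refl ; link-y₂₁ = refl ; link-y₂₃ = refl }

L₃-isGadget : IsGadget L₃
L₃-isGadget = record { link-y₁₁ = refl ; link-y₁₂ = refl ; link-y₂₁ = refl ; link-y₂₃ = refl }

module Covering {T : List Triangle} (disjoint : PairwiseVertexDisjoint T)
                (cover : ∀ v → ¬ Specified v → InV v T) where

  infix 4 _~_
  _~_ : V → V → Set
  _~_ = SameTriangle T

  ~-sym : ∀ {u v} → u ~ v → v ~ u
  ~-sym = together-sym

  ~-trans : ∀ {u v w} → u ~ v → v ~ w → u ~ w
  ~-trans = together-trans disjoint

  covered : ∀ v → False (specified? v) → InV v T
  covered v unspecified = cover v (toWitnessFalse unspecified)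

  ~-contradiction : ∀ {u v} {A : Set} → u ~ v → False (Adj⁼? u v) → A
  ~-contradiction u~v u≁v = contradiction (sameTriangle⇒adj⁼ u~v) (toWitnessFalse u≁v)

  ~⇒covered : ∀ {u v} → u ~ v → InV u T
  ~⇒covered = Any.map proj₁

  one-triangle : ∀ {v p q} → InV v T → link v ≡ (p , q) ∷ [] → v ~ p × v ~ q
  one-triangle covered-v link-v = singleton⁻ (subst (Any _) link-v (covered⇒link covered-v))

  two-triangles : ∀ {v p q p′ q′} → InV v T → link v ≡ (p , q) ∷ (p′ , q′) ∷ [] →
                  (v ~ p × v ~ q) ⊎ (v ~ p′ × v ~ q′)
  two-triangles covered-v link-v =
    Sum.map₂ singleton⁻ (Any.toSum (subst (Any _) link-v (covered⇒link covered-v)))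

  Top Middle : Gadget → Set
  Top    ℓ = x ~ y₁₁ × x₁ ~ y₂₁ × x₂ ~ y₂₃ where open Gadget ℓ
  Middle ℓ = y₁₁ ~ y₂₁ × y₁₂ ~ y₂₃ where open Gadget ℓ

  module _ {ℓ : Gadget} (G : IsGadget ℓ) where
    open Gadget ℓ
    open IsGadget G

    top-triangle⇒top : y₁₁ ~ x → y₁₁ ~ y₁₂ → Top ℓ
    top-triangle⇒top y₁₁~x y₁₁~y₁₂ = x~y₁₁ , x₁~y₂₁ , x₂~y₂₃
      where
      x~y₁₁ : x ~ y₁₁
      x~y₁₁ = ~-sym y₁₁~x

      x₁~y₂₁ : x₁ ~ y₂₁
      x₁~y₂₁ = case two-triangles (covered y₂₁ y₂₁-unspecified) link-y₂₁ of λ where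
        (inj₁ (y₂₁~x₁ , _))  → ~-sym y₂₁~x₁
        (inj₂ (y₂₁~y₁₁ , _)) → ~-contradiction (~-trans x~y₁₁ (~-sym y₂₁~y₁₁)) x≁y₂₁

      x₂~y₂₃ : x₂ ~ y₂₃
      x₂~y₂₃ = case two-triangles (covered y₂₃ y₂₃-unspecified) link-y₂₃ of λ where
        (inj₁ (y₂₃~x₂ , _))  → ~-sym y₂₃~x₂
        (inj₂ (y₂₃~y₁₂ , _)) →
          ~-contradiction (~-trans x~y₁₁ (~-trans y₁₁~y₁₂ (~-sym y₂₃~y₁₂))) x≁y₂₃

    middle-triangle⇒middle : y₁₁ ~ y₂₁ → Middle ℓ
    middle-triangle⇒middle y₁₁~y₂₁ = y₁₁~y₂₁ , y₁₂~y₂₃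
      where
      y₁₂~y₂₃ : y₁₂ ~ y₂₃
      y₁₂~y₂₃ = case two-triangles (covered y₁₂ y₁₂-unspecified) link-y₁₂ of λ where
        (inj₁ (_ , y₁₂~y₁₁)) → ~-contradiction (~-trans y₁₂~y₁₁ y₁₁~y₂₁) y₁₂≁y₂₁
        (inj₂ (y₁₂~y₂₃ , _)) → y₁₂~y₂₃

    top-or-middle : Top ℓ ⊎ Middle ℓ
    top-or-middle = case two-triangles (covered y₁₁ y₁₁-unspecified) link-y₁₁ of λ where
      (inj₁ (y₁₁~x , y₁₁~y₁₂)) → inj₁ (top-triangle⇒top y₁₁~x y₁₁~y₁₂)
      (inj₂ (y₁₁~y₂₁ , _))     → inj₂ (middle-triangle⇒middle y₁₁~y₂₁)

    middle⇒x≁y₁₁ : Middle ℓ → ¬ x ~ y₁₁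
    middle⇒x≁y₁₁ (y₁₁~y₂₁ , _) x~y₁₁ = ~-contradiction (~-trans x~y₁₁ y₁₁~y₂₁) x≁y₂₁

    middle⇒x₁≁y₂₁ : Middle ℓ → ¬ x₁ ~ y₂₁
    middle⇒x₁≁y₂₁ (y₁₁~y₂₁ , _) x₁~y₂₁ = ~-contradiction (~-trans x₁~y₂₁ (~-sym y₁₁~y₂₁)) x₁≁y₁₁

    middle⇒x₂≁y₂₃ : Middle ℓ → ¬ x₂ ~ y₂₃
    middle⇒x₂≁y₂₃ (_ , y₁₂~y₂₃) x₂~y₂₃ = ~-contradiction (~-trans x₂~y₂₃ (~-sym y₁₂~y₂₃)) x₂≁y₁₂

  top⇒caseG : Top L₁ → CaseG T
  top⇒caseG (g~a11 , gA~a21 , gB~a23) =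
    ~⇒covered g~a11 , h-uncovered , h1-uncovered , h2-uncovered , h3-uncovered
    where
    middle₂ : Middle L₂
    middle₂ = case top-or-middle L₂-isGadget of λ where
      (inj₁ (gA~b11 , _)) → ~-contradiction (~-trans (~-sym gA~a21) gA~b11) _
      (inj₂ m)            → m

    middle₃ : Middle L₃
    middle₃ = case top-or-middle L₃-isGadget of λ where
      (inj₁ (gB~c11 , _)) → ~-contradiction (~-trans (~-sym gB~a23) gB~c11) _
      (inj₂ m)            → m

    h1-uncovered : ¬ InV h1 T
    h1-uncovered covered-h1 =
      middle⇒x₁≁y₂₁ L₂-isGadget middle₂ (proj₁ (one-triangle covered-h1 refl))

    h2-uncovered : ¬ InV h2 T
    h2-uncovered covered-h2 =
      middle⇒x₂≁y₂₃ L₂-isGadget middle₂ (proj₁ (one-triangle covered-h2 refl))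

    h3-uncovered : ¬ InV h3 T
    h3-uncovered covered-h3 =
      middle⇒x₁≁y₂₁ L₃-isGadget middle₃ (proj₁ (one-triangle covered-h3 refl))

    g22~w1 : g22 ~ w1
    g22~w1 = case two-triangles (covered g22 _) refl of λ where
      (inj₁ (g22~w1 , _))  → g22~w1
      (inj₂ (g22~c23 , _)) → ⊥-elim (middle⇒x₂≁y₂₃ L₃-isGadget middle₃ g22~c23)

    h-uncovered : ¬ InV h T
    h-uncovered covered-h =
      ~-contradiction (~-trans (proj₁ (one-triangle covered-h refl)) (~-sym g22~w1)) _

  middle⇒caseH : Middle L₁ → CaseH T
  middle⇒caseH middle₁ =
    g-uncovered , ~⇒covered (~-sym w1~h) , ~⇒covered h1~b21 , ~⇒covered h2~b23 , ~⇒covered h3~c21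
    where
    g-uncovered : ¬ InV g T
    g-uncovered covered-g =
      middle⇒x≁y₁₁ L₁-isGadget middle₁ (proj₁ (one-triangle covered-g refl))

    gA~b11 : gA ~ b11
    gA~b11 = case two-triangles (covered gA _) refl of λ where
      (inj₁ (gA~a21 , _)) → ⊥-elim (middle⇒x₁≁y₂₁ L₁-isGadget middle₁ gA~a21)
      (inj₂ (gA~b11 , _)) → gA~b11

    gB~c11 : gB ~ c11
    gB~c11 = case two-triangles (covered gB _) refl of λ where
      (inj₁ (gB~a23 , _)) → ⊥-elim (middle⇒x₂≁y₂₃ L₁-isGadget middle₁ gB~a23)
      (inj₂ (gB~c11 , _)) → gB~c11

    top₂ : Top L₂
    top₂ = case top-or-middle L₂-isGadget of λ where
      (inj₁ t) → t
      (inj₂ m) → ⊥-elim (middle⇒x≁y₁₁ L₂-isGadget m gA~b11)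

    top₃ : Top L₃
    top₃ = case top-or-middle L₃-isGadget of λ where
      (inj₁ t) → t
      (inj₂ m) → ⊥-elim (middle⇒x≁y₁₁ L₃-isGadget m gB~c11)

    h1~b21 : h1 ~ b21
    h1~b21 = proj₁ (proj₂ top₂)

    h2~b23 : h2 ~ b23
    h2~b23 = proj₂ (proj₂ top₂)

    h3~c21 : h3 ~ c21
    h3~c21 = proj₁ (proj₂ top₃)

    g22~c23 : g22 ~ c23
    g22~c23 = proj₂ (proj₂ top₃)

    w1~h : w1 ~ h
    w1~h = case two-triangles (covered w1 _) refl of λ where
      (inj₁ (w1~g22 , _)) → ~-contradiction (~-trans w1~g22 g22~c23) _
      (inj₂ (_ , w1~h))   → w1~h

  caseG⊎caseH : CaseG T ⊎ CaseH T
  caseG⊎caseH = Sum.map top⇒caseG middle⇒caseH (top-or-middle L₁-isGadget)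

triangle : (x y z : V) → {True (Adj? x y)} → {True (Adj? y z)} → {True (Adj? x z)} → Triangle
triangle x y z {xy} {yz} {xz} = tri x y z (toWitness xy) (toWitness yz) (toWitness xz)

T-caseG T-caseH : List Triangle
T-caseG = triangle g a11 a12 ∷ triangle a21 a22 gA ∷ triangle a23 a24 gB ∷
          triangle b11 b21 b22 ∷ triangle b12 b23 b24 ∷
          triangle c11 c21 c22 ∷ triangle c12 c23 c24 ∷
          triangle g22 w1 w2 ∷ []
T-caseH = triangle a11 a21 a22 ∷ triangle a12 a23 a24 ∷
          triangle gA b11 b12 ∷ triangle b21 b22 h1 ∷ triangle b23 b24 h2 ∷
          triangle gB c11 c12 ∷ triangle c21 c22 h3 ∷ triangle c23 c24 g22 ∷
          triangle w1 w2 h ∷ []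

inV? : ∀ v T → Dec (InV v T)
inV? v = any? (λ t → any? (v ≟_) (verts t))

admissible? : ∀ T → Dec (Admissible T)
admissible? T =
  allPairs? (λ s t → disjoint? (verts s) (verts t)) T ×-dec
  ∀-vertex? (λ v → ¬? (specified? v) →-dec inV? v T) ×-dec
  (inV? g T ×-dec ¬? (inV? h T) ⊎-dec ¬? (inV? g T) ×-dec inV? h T)

caseG? : ∀ T → Dec (CaseG T)
caseG? T =
  inV? g T ×-dec ¬? (inV? h T) ×-dec ¬? (inV? h1 T) ×-dec ¬? (inV? h2 T) ×-dec ¬? (inV? h3 T)

caseH? : ∀ T → Dec (CaseH T)
caseH? T = ¬? (inV? g T) ×-dec inV? h T ×-dec inV? h1 T ×-dec inV? h2 T ×-dec inV? h3 T

lemma5p1 : ((T : List Triangle) → Admissible T → CaseG T ⊎ CaseH T)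
           × Σ (List Triangle) (λ T → Admissible T × CaseG T)
           × Σ (List Triangle) (λ T → Admissible T × CaseH T)
lemma5p1 = (λ T (disjoint , cover , _) → Covering.caseG⊎caseH disjoint cover)
         , (T-caseG , from-yes (admissible? T-caseG) , from-yes (caseG? T-caseG))
         , (T-caseH , from-yes (admissible? T-caseH) , from-yes (caseH? T-caseH))
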